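{- In any $\frac32$-institution, let $(\theta_0,\theta_1,\theta_2)$ be a lax cocone with vertex $\Sigma$ for a span $(\varphi_1,\varphi_2)$ of signature morphisms, and let $\mu$ be a signature morphism with $\operatorname{dom}\mu=\Sigma$. Then: 1. if $(\theta_0,\theta_1,\theta_2)$ has weak model amalgamation and $\mu$ is model conservative, then the lax cocone $(\theta_0;\mu,\theta_1;\mu,\theta_2;\mu)$ has weak model amalgamation; 2. if there exists a lax cocone $(\theta'_0,\theta'_1,\theta'_2)$ of the same span with weak model amalgamation such that $\theta_k;\mu\le\theta'_k$ for $k=0,1,2$, and $\mu$ is $\mathit{Mod}$-maximal and $\mathit{Mod}$-strict, then $(\theta_0,\theta_1,\theta_2)$ has weak model amalgamation.
   Context: Composition is diagrammatic. A $\frac32$-category: category with partially ordered hom-sets, composition monotone. A $\frac32$-institution $(\mathit{Sign},\mathit{Sen},\mathit{Mod},\models)$ consists of: a $\frac32$-category $\mathit{Sign}$; for each signature $\Sigma$ a set $\mathit{Sen}(\Sigma)$ and for each $\varphi:\Sigma\to\Sigma'$ a partial function $\mathit{Sen}(\varphi):\mathit{Sen}(\Sigma)\rightharpoonup\mathit{Sen}(\Sigma')$, monotone in $\varphi$ (w.r.t. graph inclusion) and either lax ($\mathit{Sen}(\varphi);\mathit{Sen}(\varphi')\subseteq\mathit{Sen}(\varphi;\varphi')$, $1\subseteq\mathit{Sen}(1_\Sigma)$) or oplax (reverse inclusions); for each $\Sigma$ a category $\mathit{Mod}(\Sigma)$ of models and for each $\varphi:\Sigma\to\Sigma'$ a lax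 functor $\mathit{Mod}(\varphi)$ from $\mathit{Mod}(\Sigma')$ to the power category of $\mathit{Mod}(\Sigma)$, assigning in particular to each $\Sigma'$-model $M'$ a set $\mathit{Mod}(\varphi)M'$ of $\Sigma$-models, such that $\varphi\le\theta\Rightarrow\mathit{Mod}(\theta)M'\subseteq\mathit{Mod}(\varphi)M'$, $\bigcup_{M'\in\mathit{Mod}(\varphi')M''}\mathit{Mod}(\varphi)M'\subseteq\mathit{Mod}(\varphi;\varphi')M''$ and $M\in\mathit{Mod}(1_\Sigma)M$; and satisfaction relations $\models_\Sigma$ with the Satisfaction Condition: $M'\models\mathit{Sen}(\varphi)\rho$ iff $M\models\rho$, for all $M\in\mathit{Mod}(\varphi)M'$, $\rho\in\mathrm{dom}\,\mathit{Sen}(\varphi)$. For a span $\varphi_k:\Sigma_0\to\Sigma_k$ ($k=1,2$), a lax cocone is $\theta_k:\Sigma_k\to\Sigma$ ($k=0,1,2$) with $\varphi_k;\theta_k\le\theta_0$. A model of the span: $\Sigma_k$-models $M_k$ with $M_0\in\mathit{Mod}(\varphi_k)M_k$, $k=1,2$. The lax cocone has weak model amalgamation if each model of the span admits some $\Sigma$-model $M$ with $M_k\in\mathit{Mod}(\theta_k)M$, $k=0,1,2$. A signature morphism $\mu$ is: model conservative if for each $\operatorname{dom}\mu$-model $M$ there is a $\operatorname{cod}\mu$-model $M'$ with $M\in\mathit{Mod}(\mu)M'$; $\mathit{Mod}$-maximal if $\mathit{Mod}(\mu)M'$ is a singleton for every $\operatorname{cod}\mu$-model $M'$; $\mathit{Mod}$-strict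 if for each $\theta$ with $\operatorname{cod}\theta=\operatorname{dom}\mu$ and each $\operatorname{cod}\mu$-model $M''$, $\bigcup_{M'\in\mathit{Mod}(\mu)M''}\mathit{Mod}(\theta)M'=\mathit{Mod}(\theta;\mu)M''$. -}

module Defs where

open import Level using (suc; zero)
open import Data.Product using (Σ; _×_; _,_; ∃-syntax)
open import Data.Sum using (_⊎_)
open import Relation.Binary.PropositionalEquality using (_≡_)

record ThreeHalfInstitution : Set₁ where
  infixr 9 _⨾_
  infix 4 _≤_
  field
    Sig    : Set
    Hom    : Sig → Sig → Set
    idS    : (A : Sig) → Hom A A
    _⨾_    : {A B C : Sig} → Hom A B → Hom B C → Hom A C
    idˡ    : {A B : Sig} (f : Hom A B) → idS A ⨾ f ≡ f
    idʳ    : {A B : Sig} (f : Hom A B) → f ⨾ idS B ≡ f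
    assoc  : {A B C D : Sig} (f : Hom A B) (g : Hom B C) (h : Hom C D) →
             (f ⨾ g) ⨾ h ≡ f ⨾ (g ⨾ h)
    _≤_     : {A B : Sig} → Hom A B → Hom A B → Set
    ≤-refl  : {A B : Sig} (f : Hom A B) → f ≤ f
    ≤-trans : {A B : Sig} {f g h : Hom A B} → f ≤ g → g ≤ h → f ≤ h
    ≤-antisym : {A B : Sig} {f g : Hom A B} → f ≤ g → g ≤ f → f ≡ g
    ⨾-mono  : {A B C : Sig} {f f' : Hom A B} {g g' : Hom B C} →
              f ≤ f' → g ≤ g' → f ⨾ g ≤ f' ⨾ g'

    -- sentences; Sen(φ) is a partial function, given by its graph SenMap φ ρ ρ'
    -- ("Sen(φ) ρ is defined and equals ρ'")
    Sen       : Sig → Set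
    SenMap    : {A B : Sig} → Hom A B → Sen A → Sen B → Set
    SenMap-functional : {A B : Sig} (φ : Hom A B) {ρ : Sen A} {ρ₁ ρ₂ : Sen B} →
                        SenMap φ ρ ρ₁ → SenMap φ ρ ρ₂ → ρ₁ ≡ ρ₂
    SenMap-mono : {A B : Sig} {φ θ : Hom A B} → φ ≤ θ →
                  {ρ : Sen A} {ρ' : Sen B} → SenMap φ ρ ρ' → SenMap θ ρ ρ'
    Sen-lax-or-oplax :
      -- lax: Sen(φ);Sen(φ') ⊆ Sen(φ;φ') and 1 ⊆ Sen(1)
      (  ({A B C : Sig} (φ : Hom A B) (φ' : Hom B C) {ρ : Sen A} {ρ' : Sen B} {ρ'' : Sen C} →
            SenMap φ ρ ρ' → SenMap φ' ρ' ρ'' → SenMap (φ ⨾ φ') ρ ρ'')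
       × ({A : Sig} (ρ : Sen A) → SenMap (idS A) ρ ρ))
      ⊎
      -- oplax: Sen(φ;φ') ⊆ Sen(φ);Sen(φ') and Sen(1) ⊆ 1
      (  ({A B C : Sig} (φ : Hom A B) (φ' : Hom B C) {ρ : Sen A} {ρ'' : Sen C} →
            SenMap (φ ⨾ φ') ρ ρ'' → Σ (Sen B) λ ρ' → SenMap φ ρ ρ' × SenMap φ' ρ' ρ'')
       × ({A : Sig} {ρ ρ' : Sen A} → SenMap (idS A) ρ ρ' → ρ ≡ ρ'))

    Mod     : Sig → Set
    MHom    : {A : Sig} → Mod A → Mod A → Set
    idM     : {A : Sig} (M : Mod A) → MHom M M
    _∘M_    : {A : Sig} {M N P : Mod A} → MHom M N → MHom N P → MHom M P
    idMˡ    : {A : Sig} {M N : Mod A} (h : MHom M N) → idM M ∘M h ≡ h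
    idMʳ    : {A : Sig} {M N : Mod A} (h : MHom M N) → h ∘M idM N ≡ h
    assocM  : {A : Sig} {M N P Q : Mod A} (f : MHom M N) (g : MHom N P) (h : MHom P Q) →
              (f ∘M g) ∘M h ≡ f ∘M (g ∘M h)

    -- object part of the lax functor Mod(φ): ModMap φ M' M  means  M ∈ Mod(φ) M'
    ModMap  : {A B : Sig} → Hom A B → Mod B → Mod A → Set
    ModMap-antitone : {A B : Sig} {φ θ : Hom A B} → φ ≤ θ →
                      {M' : Mod B} {M : Mod A} → ModMap θ M' M → ModMap φ M' M
    ModMap-comp : {A B C : Sig} (φ : Hom A B) (φ' : Hom B C)
                  {M'' : Mod C} {M' : Mod B} {M : Mod A} →
                  ModMap φ' M'' M' → ModMap φ M' M → ModMap (φ ⨾ φ') M'' M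
    ModMap-id   : {A : Sig} (M : Mod A) → ModMap (idS A) M M

    _⊨_ : {A : Sig} → Mod A → Sen A → Set
    satisfaction : {A B : Sig} (φ : Hom A B) {M' : Mod B} {M : Mod A}
                   {ρ : Sen A} {ρ' : Sen B} →
                   ModMap φ M' M → SenMap φ ρ ρ' →
                   (M' ⊨ ρ' → M ⊨ ρ) × (M ⊨ ρ → M' ⊨ ρ')

module _ (I : ThreeHalfInstitution) where
  open ThreeHalfInstitution I

  IsLaxCocone : {S₀ S₁ S₂ S : Sig} (φ₁ : Hom S₀ S₁) (φ₂ : Hom S₀ S₂)
                (θ₀ : Hom S₀ S) (θ₁ : Hom S₁ S) (θ₂ : Hom S₂ S) → Set
  IsLaxCocone φ₁ φ₂ θ₀ θ₁ θ₂ = (φ₁ ⨾ θ₁ ≤ θ₀) × (φ₂ ⨾ θ₂ ≤ θ₀)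

  WeakModelAmalgamation : {S₀ S₁ S₂ S : Sig} (φ₁ : Hom S₀ S₁) (φ₂ : Hom S₀ S₂)
                (θ₀ : Hom S₀ S) (θ₁ : Hom S₁ S) (θ₂ : Hom S₂ S) → Set
  WeakModelAmalgamation {S₀} {S₁} {S₂} {S} φ₁ φ₂ θ₀ θ₁ θ₂ =
    (M₀ : Mod S₀) (M₁ : Mod S₁) (M₂ : Mod S₂) →
    ModMap φ₁ M₁ M₀ → ModMap φ₂ M₂ M₀ →
    Σ (Mod S) λ M → ModMap θ₀ M M₀ × ModMap θ₁ M M₁ × ModMap θ₂ M M₂

  ModelConservative : {A B : Sig} → Hom A B → Set
  ModelConservative {A} {B} μ = (M : Mod A) → Σ (Mod B) λ M' → ModMap μ M' M

  ModMaximal : {A B : Sig} → Hom A B → Set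
  ModMaximal {A} {B} μ = (M' : Mod B) →
    Σ (Mod A) λ M → ModMap μ M' M × ((N : Mod A) → ModMap μ M' N → N ≡ M)

  ModStrict : {A B : Sig} → Hom A B → Set
  ModStrict {A} {B} μ = {C : Sig} (θ : Hom C A) (M'' : Mod B) (N : Mod C) →
    ((Σ (Mod A) λ M' → ModMap μ M'' M' × ModMap θ M' N) → ModMap (θ ⨾ μ) M'' N)
    × (ModMap (θ ⨾ μ) M'' N → Σ (Mod A) λ M' → ModMap μ M'' M' × ModMap θ M' N)

module Submission where

-- (1) Pushing forward.  An amalgamation M of a span model along (θ₀,θ₁,θ₂) is
--     lifted, by model conservativity, to some M' with M ∈ Mod(μ)M'; the lax
--     composition law of Mod then gives Mₖ ∈ Mod(θₖ;μ)M'.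
-- (2) Pulling back.  Take an amalgamation M' along the larger cocone (θ'ₖ).
--     Antitonicity of Mod turns Mₖ ∈ Mod(θ'ₖ)M' into Mₖ ∈ Mod(θₖ;μ)M';
--     strictness splits this through some reduct in Mod(μ)M', and maximality
--     says that reduct is the unique one, M.
--
-- Neither argument uses the lax-cocone inequalities; the lemmas are stated
-- without them and the main theorem simply discards those hypotheses.

open import Defs
open import Data.Product using (Σ; _×_; _,_)
open import Relation.Binary.PropositionalEquality using (_≡_; subst)

module _ (I : ThreeHalfInstitution) where
  open ThreeHalfInstitution I

  amalgamation-along-conservative :
    {S₀ S₁ S₂ S S' : Sig} (φ₁ : Hom S₀ S₁) (φ₂ : Hom S₀ S₂)
    (θ₀ : Hom S₀ S) (θ₁ : Hom S₁ S) (θ₂ : Hom S₂ S) (μ : Hom S S') →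
    WeakModelAmalgamation I φ₁ φ₂ θ₀ θ₁ θ₂ → ModelConservative I μ →
    WeakModelAmalgamation I φ₁ φ₂ (θ₀ ⨾ μ) (θ₁ ⨾ μ) (θ₂ ⨾ μ)
  amalgamation-along-conservative φ₁ φ₂ θ₀ θ₁ θ₂ μ amalg conservative
                                  M₀ M₁ M₂ p₁ p₂
    with amalg M₀ M₁ M₂ p₁ p₂
  ... | M , q₀ , q₁ , q₂ with conservative M
  ... | M' , μ-reduct =
    M' , ModMap-comp θ₀ μ μ-reduct q₀
       , ModMap-comp θ₁ μ μ-reduct q₁
       , ModMap-comp θ₂ μ μ-reduct q₂

  -- For a Mod-strict μ, and M the unique μ-reduct of M', every (θ;μ)-reduct
  -- of M' is a θ-reduct of M: strictness factors it through some μ-reduct,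
  -- which by uniqueness is M.
  reduct-of-unique-reduct : {C S S' : Sig} (μ : Hom S S') → ModStrict I μ →
    {M' : Mod S'} {M : Mod S} →
    ((K : Mod S) → ModMap μ M' K → K ≡ M) →
    (θ : Hom C S) {N : Mod C} → ModMap (θ ⨾ μ) M' N → ModMap θ M N
  reduct-of-unique-reduct μ strict {M'} unique θ {N} r
    with (_ , split) ← strict θ M' N
    with split r
  ... | K , μ-reduct , θ-reduct = subst (λ L → ModMap θ L N) (unique K μ-reduct) θ-reduct

  reduct-below : {C S S' : Sig} (μ : Hom S S') → ModStrict I μ →
    {M' : Mod S'} {M : Mod S} →
    ((K : Mod S) → ModMap μ M' K → K ≡ M) →
    (θ : Hom C S) {θ' : Hom C S'} → θ ⨾ μ ≤ θ' →
    {N : Mod C} → ModMap θ' M' N → ModMap θ M N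
  reduct-below μ strict unique θ le r =
    reduct-of-unique-reduct μ strict unique θ (ModMap-antitone le r)

  amalgamation-along-maximal-strict :
    {S₀ S₁ S₂ S S' : Sig} (φ₁ : Hom S₀ S₁) (φ₂ : Hom S₀ S₂)
    (θ₀ : Hom S₀ S) (θ₁ : Hom S₁ S) (θ₂ : Hom S₂ S) (μ : Hom S S')
    {θ₀' : Hom S₀ S'} {θ₁' : Hom S₁ S'} {θ₂' : Hom S₂ S'} →
    WeakModelAmalgamation I φ₁ φ₂ θ₀' θ₁' θ₂' →
    θ₀ ⨾ μ ≤ θ₀' → θ₁ ⨾ μ ≤ θ₁' → θ₂ ⨾ μ ≤ θ₂' →
    ModMaximal I μ → ModStrict I μ →
    WeakModelAmalgamation I φ₁ φ₂ θ₀ θ₁ θ₂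
  amalgamation-along-maximal-strict φ₁ φ₂ θ₀ θ₁ θ₂ μ amalg' le₀ le₁ le₂
                                    maximal strict M₀ M₁ M₂ p₁ p₂
    with amalg' M₀ M₁ M₂ p₁ p₂
  ... | M' , q₀ , q₁ , q₂ with maximal M'
  ... | M , _ , unique =
    M , reduct-below μ strict unique θ₀ le₀ q₀
      , reduct-below μ strict unique θ₁ le₁ q₁
      , reduct-below μ strict unique θ₂ le₂ q₂

mainTheorem5 : (I : ThreeHalfInstitution) →
    let open ThreeHalfInstitution I in
    {S₀ S₁ S₂ S S' : Sig} (φ₁ : Hom S₀ S₁) (φ₂ : Hom S₀ S₂)
    (θ₀ : Hom S₀ S) (θ₁ : Hom S₁ S) (θ₂ : Hom S₂ S) →
    IsLaxCocone I φ₁ φ₂ θ₀ θ₁ θ₂ →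
    (μ : Hom S S') →
    ((WeakModelAmalgamation I φ₁ φ₂ θ₀ θ₁ θ₂ → ModelConservative I μ →
        WeakModelAmalgamation I φ₁ φ₂ (θ₀ ⨾ μ) (θ₁ ⨾ μ) (θ₂ ⨾ μ))
    × ((Σ (Hom S₀ S') λ θ₀' → Σ (Hom S₁ S') λ θ₁' → Σ (Hom S₂ S') λ θ₂' →
          IsLaxCocone I φ₁ φ₂ θ₀' θ₁' θ₂'
          × WeakModelAmalgamation I φ₁ φ₂ θ₀' θ₁' θ₂'
          × (θ₀ ⨾ μ ≤ θ₀') × (θ₁ ⨾ μ ≤ θ₁') × (θ₂ ⨾ μ ≤ θ₂')) →
        ModMaximal I μ → ModStrict I μ →
        WeakModelAmalgamation I φ₁ φ₂ θ₀ θ₁ θ₂))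
mainTheorem5 I φ₁ φ₂ θ₀ θ₁ θ₂ _ μ =
    amalgamation-along-conservative I φ₁ φ₂ θ₀ θ₁ θ₂ μ
  , λ { (_ , _ , _ , _ , amalg' , le₀ , le₁ , le₂) →
          amalgamation-along-maximal-strict I φ₁ φ₂ θ₀ θ₁ θ₂ μ amalg' le₀ le₁ le₂ }
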